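{- If a finite connected graph $G$ admits a Hamiltonian path (a path containing every vertex of $G$ exactly once), then $\mu(G)=\nu(G)$.
   Context: All graphs are finite, simple, undirected and loopless. $\nu(G)$ is the maximum size of a matching in $G$. $\lambda(G)=\max\{|H|+|H'| : H,H' \text{ are disjoint matchings in } G\}$, $\Lambda(G)$ is the set of ordered pairs $(H,H')$ of disjoint matchings of $G$ with $|H|+|H'|=\lambda(G)$, and $\mu(G)=\max\{|H| : (H,H')\in\Lambda(G)\}$. -}

module Defs where

open import Level using (0ℓ)
open import Data.Nat using (ℕ; _≤_)
open import Data.Fin using (Fin) renaming (_<_ to _<ᶠ_)
open import Data.List using (List; []; _∷_; length; concatMap)
open import Data.List.Membership.Propositional using (_∈_; _∉_)
open import Data.List.Relation.Unary.All using (All)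
open import Data.List.Relation.Unary.Linked using (Linked)
open import Data.List.Relation.Unary.Unique.Propositional using (Unique)
open import Data.Product using (Σ; _×_; _,_)
open import Relation.Nullary using (¬_)
open import Relation.Binary.PropositionalEquality using (_≡_)

record Graph : Set₁ where
  field
    n     : ℕ
    Adj   : Fin n → Fin n → Set
    sym   : ∀ {u v} → Adj u v → Adj v u
    irrefl : ∀ {v} → ¬ Adj v v

open Graph public

-- An edge {u,v} is represented canonically as the ordered pair (u , v) with u < v.
Edge : Graph → Set
Edge G = Fin (n G) × Fin (n G)

IsEdge : (G : Graph) → Edge G → Set
IsEdge G (u , v) = (u <ᶠ v) × Adj G u v

endpoints : {G : Graph} → Edge G → List (Fin (n G))
endpoints (u , v) = u ∷ v ∷ []

-- Uniqueness of the list of all endpoints expresses both that the edges are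
-- distinct and that no two edges share a vertex. |H| = length H.
IsMatching : (G : Graph) → List (Edge G) → Set
IsMatching G H = All (IsEdge G) H × Unique (concatMap (endpoints {G}) H)

Disjoint : {G : Graph} → List (Edge G) → List (Edge G) → Set
Disjoint H H' = ∀ e → e ∈ H → e ∉ H'

IsNu : Graph → ℕ → Set
IsNu G k = Σ (List (Edge G)) (λ H → IsMatching G H × length H ≡ k)
         × (∀ H → IsMatching G H → length H ≤ k)

IsDisjointPair : (G : Graph) → List (Edge G) → List (Edge G) → Set
IsDisjointPair G H H' = IsMatching G H × IsMatching G H' × Disjoint {G} H H'

IsLambda : Graph → ℕ → Set
IsLambda G k = Σ (List (Edge G)) (λ H → Σ (List (Edge G)) (λ H' →
                   IsDisjointPair G H H' × length H Data.Nat.+ length H' ≡ k))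
             × (∀ H H' → IsDisjointPair G H H' → length H Data.Nat.+ length H' ≤ k)

InLambdaSet : (G : Graph) → List (Edge G) → List (Edge G) → Set
InLambdaSet G H H' = IsDisjointPair G H H' × IsLambda G (length H Data.Nat.+ length H')

IsMu : Graph → ℕ → Set
IsMu G k = Σ (List (Edge G)) (λ H → Σ (List (Edge G)) (λ H' →
               InLambdaSet G H H' × length H ≡ k))
         × (∀ H H' → InLambdaSet G H H' → length H ≤ k)

data Walk (G : Graph) : Fin (n G) → Fin (n G) → Set where
  here : ∀ {v} → Walk G v v
  step : ∀ {u w v} → Adj G u w → Walk G w v → Walk G u v

Connected : Graph → Set
Connected G = ∀ u v → Walk G u v

IsHamiltonianPath : (G : Graph) → List (Fin (n G)) → Set
IsHamiltonianPath G p = Linked (Adj G) p × Unique p × (∀ v → v ∈ p)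

HasHamiltonianPath : Graph → Set
HasHamiltonianPath G = Σ (List (Fin (n G))) (IsHamiltonianPath G)

module Submission where

-- Proof idea.  Write n for the number of vertices, a = μ(G), b = ν(G).
--
--  * a ≤ b, since the first matching of any pair in Λ(G) is a matching.
--  * 2b ≤ n, since the 2|M| endpoints of a matching M are distinct vertices.
--  * λ(G) ≤ 2a: if (H , H') ∈ Λ(G) realises μ, then so does the swapped pair
--    (H' , H), hence |H'| ≤ a and λ(G) = |H| + |H'| ≤ 2a.
--  * n ≤ λ(G) + 1: the edges of a Hamiltonian path v₁ … v_k (k ≥ n), taken
--    alternately, form two disjoint matchings with k - 1 edges in total.
--
-- Chaining the last three gives 2b ≤ n ≤ 2a + 1, hence b ≤ a.

open import Defs
open import Data.Nat using (ℕ; zero; suc; _+_; _≤_; z≤n; s≤s)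
open import Data.Nat.Properties
  using (+-suc; +-comm; +-monoʳ-≤; ≤-antisym; module ≤-Reasoning)
open import Data.Fin using (Fin)
open import Data.Fin.Properties using (<-cmp; injective⇒≤)
open import Data.List using (List; []; _∷_; length; lookup; concatMap; _++_)
open import Data.List.Membership.Propositional using (_∈_; _∉_)
open import Data.List.Membership.Propositional.Properties
  using (∈-lookup; ∈-++⁻; ∈-map⁺; ∈-concat⁺′)
open import Data.List.Relation.Binary.Subset.Propositional using (_⊆_)
open import Data.List.Relation.Unary.Any using (here; there; index)
open import Data.List.Relation.Unary.Any.Properties using (lookup-index)
open import Data.List.Relation.Unary.All using (All; []; _∷_)
import Data.List.Relation.Unary.All as All
open import Data.List.Relation.Unary.All.Properties using (¬Any⇒All¬)
open import Data.List.Relation.Unary.AllPairs using ([]; _∷_)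
open import Data.List.Relation.Unary.Linked using (Linked; _∷_)
open import Data.List.Relation.Unary.Unique.Propositional using (Unique)
open import Data.Product using (∃; _×_; _,_)
open import Data.Sum using (inj₁; inj₂)
open import Data.Empty using (⊥-elim)
open import Function.Definitions using (Injective)
open import Relation.Binary.Definitions using (tri<; tri≈; tri>)
open import Relation.Binary.PropositionalEquality
  using (_≡_; _≢_; refl; trans; cong; subst; module ≡-Reasoning)
  renaming (sym to ≡-sym)

lookup-injective : {A : Set} {xs : List A} → Unique xs →
                   Injective _≡_ _≡_ (lookup xs)
lookup-injective {xs = x ∷ xs} _ {Fin.zero} {Fin.zero} _ = refl
lookup-injective {xs = x ∷ xs} (x∉xs ∷ _) {Fin.zero} {Fin.suc j} x≡xⱼ =
  ⊥-elim (All.lookup x∉xs (∈-lookup j) x≡xⱼ)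
lookup-injective {xs = x ∷ xs} (x∉xs ∷ _) {Fin.suc i} {Fin.zero} xᵢ≡x =
  ⊥-elim (All.lookup x∉xs (∈-lookup i) (≡-sym xᵢ≡x))
lookup-injective {xs = x ∷ xs} (_ ∷ u) {Fin.suc i} {Fin.suc j} xᵢ≡xⱼ =
  cong Fin.suc (lookup-injective u xᵢ≡xⱼ)

unique⇒length≤ : {m : ℕ} (xs : List (Fin m)) → Unique xs → length xs ≤ m
unique⇒length≤ xs u = injective⇒≤ (lookup-injective u)

-- A list containing every element of Fin m has at least m entries:
-- sending v to the position of one of its occurrences is injective.
covering⇒length≥ : {m : ℕ} (xs : List (Fin m)) → (∀ v → v ∈ xs) → m ≤ length xs
covering⇒length≥ xs cover = injective⇒≤ position-injective
  where
  position-injective : Injective _≡_ _≡_ (λ v → index (cover v))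
  position-injective {u} {v} same-position =
    trans (lookup-index (cover u))
          (trans (cong (lookup xs) same-position) (≡-sym (lookup-index (cover v))))

halve : ∀ b c → b + b ≤ suc (c + c) → b ≤ c
halve zero    c       _ = z≤n
halve (suc b) zero    (s≤s 2b+1≤0) rewrite +-suc b b with 2b+1≤0
... | ()
halve (suc b) (suc c) (s≤s 2b+1≤2c+1) rewrite +-suc b b | +-suc c c
  with 2b+1≤2c+1
... | s≤s 2b≤2c = s≤s (halve b c 2b≤2c)

module _ (G : Graph) where
  private
    V = Fin (n G)
    E = Edge G

  ends : List E → List V
  ends = concatMap (endpoints {G})

  ends-length : (H : List E) → length (ends H) ≡ length H + length H
  ends-length []      = refl
  ends-length (e ∷ H) =
    cong suc (trans (cong suc (ends-length H)) (≡-sym (+-suc (length H) (length H))))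

  ends-∈ : ∀ {e v} {H : List E} → e ∈ H → v ∈ endpoints {G} e → v ∈ ends H
  ends-∈ e∈H v∈e = ∈-concat⁺′ v∈e (∈-map⁺ (endpoints {G}) e∈H)

  matching-size : (H : List E) → IsMatching G H → length H + length H ≤ n G
  matching-size H (_ , distinct) =
    subst (_≤ n G) (ends-length H) (unique⇒length≤ (ends H) distinct)

  ν-bound : ∀ {b} → IsNu G b → b + b ≤ n G
  ν-bound ((M , isM , refl) , _) = matching-size M isM

  μ≤ν : ∀ {a b} → IsMu G a → IsNu G b → a ≤ b
  μ≤ν ((H , _ , ((isM , _) , _) , refl) , _) (_ , maximal) = maximal H isM

  swap-pair : ∀ {H H'} → IsDisjointPair G H H' → IsDisjointPair G H' H
  swap-pair (isM , isM' , disjoint) = isM' , isM , λ e e∈H' e∈H → disjoint e e∈H e∈H'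

  -- μ(G) is at least half of λ(G): swapping a pair realising μ stays in Λ(G).
  μ-half-λ : ∀ {a} → IsMu G a → ∃ λ l → IsLambda G l × l ≤ a + a
  μ-half-λ ((H , H' , (pair , isλ) , refl) , maximal) =
    length H + length H' , isλ , +-monoʳ-≤ (length H) H'≤μ
    where
    H'≤μ : length H' ≤ length H
    H'≤μ = maximal H' H
      (swap-pair pair , subst (IsLambda G) (+-comm (length H) (length H')) isλ)

  edge : V → V → E
  edge x y with <-cmp x y
  ... | tri< _ _ _ = x , y
  ... | tri≈ _ _ _ = y , x
  ... | tri> _ _ _ = y , x

  edge-valid : ∀ x y → Adj G x y → IsEdge G (edge x y)
  edge-valid x y x~y with <-cmp x y
  ... | tri< x<y _ _ = x<y , x~y
  ... | tri≈ _ refl _ = ⊥-elim (irrefl G x~y)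
  ... | tri> _ _ y<x = y<x , Graph.sym G x~y

  edge-left : ∀ x y → x ∈ endpoints {G} (edge x y)
  edge-left x y with <-cmp x y
  ... | tri< _ _ _ = here refl
  ... | tri≈ _ _ _ = there (here refl)
  ... | tri> _ _ _ = there (here refl)

  edge-ends : ∀ x y r → endpoints {G} (edge x y) ⊆ x ∷ y ∷ r
  edge-ends x y r v∈ with <-cmp x y | v∈
  ... | tri< _ _ _ | here v≡x         = here v≡x
  ... | tri< _ _ _ | there (here v≡y) = there (here v≡y)
  ... | tri≈ _ _ _ | here v≡y         = there (here v≡y)
  ... | tri≈ _ _ _ | there (here v≡x) = here v≡x
  ... | tri> _ _ _ | here v≡y         = there (here v≡y)
  ... | tri> _ _ _ | there (here v≡x) = here v≡x

  edge-fresh : ∀ x y (vs : List V) → x ≢ y → x ∉ vs → y ∉ vs → Unique vs →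
               Unique (endpoints {G} (edge x y) ++ vs)
  edge-fresh x y vs x≢y x∉ y∉ u with <-cmp x y
  ... | tri< _ _ _ = (x≢y ∷ ¬Any⇒All¬ vs x∉) ∷ ¬Any⇒All¬ vs y∉ ∷ u
  ... | tri≈ _ _ _ = ((λ y≡x → x≢y (≡-sym y≡x)) ∷ ¬Any⇒All¬ vs y∉) ∷ ¬Any⇒All¬ vs x∉ ∷ u
  ... | tri> _ _ _ = ((λ y≡x → x≢y (≡-sym y≡x)) ∷ ¬Any⇒All¬ vs y∉) ∷ ¬Any⇒All¬ vs x∉ ∷ u

  mutual
    odd-edges : List V → List E
    odd-edges (x ∷ y ∷ r) = edge x y ∷ even-edges (y ∷ r)
    odd-edges _           = []

    even-edges : List V → List E
    even-edges (x ∷ y ∷ r) = odd-edges (y ∷ r)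
    even-edges _           = []

  alternating-valid : ∀ p → Linked (Adj G) p →
                      All (IsEdge G) (odd-edges p) × All (IsEdge G) (even-edges p)
  alternating-valid []          _           = [] , []
  alternating-valid (x ∷ [])    _           = [] , []
  alternating-valid (x ∷ y ∷ r) (x~y ∷ lnk) =
    let valid-odd , valid-even = alternating-valid (y ∷ r) lnk
    in edge-valid x y x~y ∷ valid-even , valid-odd

  mutual
    odd-support : ∀ p → ends (odd-edges p) ⊆ p
    odd-support (x ∷ y ∷ r) v∈ with ∈-++⁻ (endpoints {G} (edge x y)) v∈
    ... | inj₁ v∈xy = edge-ends x y r v∈xy
    ... | inj₂ v∈rest = there (there (even-support y r v∈rest))

    even-support : ∀ x r → ends (even-edges (x ∷ r)) ⊆ r
    even-support x (y ∷ r) v∈ = odd-support (y ∷ r) v∈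

  alternating-distinct : ∀ p → Unique p →
                         Unique (ends (odd-edges p)) × Unique (ends (even-edges p))
  alternating-distinct []          _ = [] , []
  alternating-distinct (x ∷ [])    _ = [] , []
  alternating-distinct (x ∷ y ∷ r) ((x≢y ∷ x∉r) ∷ u@(y∉r ∷ _)) =
    let distinct-odd , distinct-even = alternating-distinct (y ∷ r) u
    in edge-fresh x y (ends (even-edges (y ∷ r))) x≢y
         (λ x∈ → All.lookup x∉r (even-support y r x∈) refl)
         (λ y∈ → All.lookup y∉r (even-support y r y∈) refl)
         distinct-even ,
       distinct-odd

  -- No edge is both odd and even: the first odd edge contains v₁, which
  -- appears in no even edge, and the rest follows by shifting the path.
  alternating-disjoint : ∀ p → Unique p → Disjoint {G} (odd-edges p) (even-edges p)
  alternating-disjoint (x ∷ y ∷ r) ((x≢y ∷ x∉r) ∷ _) e (here refl) e∈even =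
    All.lookup (x≢y ∷ x∉r) (odd-support (y ∷ r) (ends-∈ e∈even (edge-left x y))) refl
  alternating-disjoint (x ∷ y ∷ r) (_ ∷ u) e (there e∈even') e∈odd' =
    alternating-disjoint (y ∷ r) u e e∈odd' e∈even'

  alternating-pair : ∀ p → Linked (Adj G) p → Unique p →
                     IsDisjointPair G (odd-edges p) (even-edges p)
  alternating-pair p lnk u =
    let valid-odd , valid-even = alternating-valid p lnk
        distinct-odd , distinct-even = alternating-distinct p u
    in (valid-odd , distinct-odd) , (valid-even , distinct-even) , alternating-disjoint p u

  alternating-size : ∀ x r → length (odd-edges (x ∷ r)) + length (even-edges (x ∷ r)) ≡ length r
  alternating-size x []      = refl
  alternating-size x (y ∷ r) = cong suc (begin
      length (even-edges (y ∷ r)) + length (odd-edges (y ∷ r))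
    ≡⟨ +-comm (length (even-edges (y ∷ r))) _ ⟩
      length (odd-edges (y ∷ r)) + length (even-edges (y ∷ r))
    ≡⟨ alternating-size y r ⟩
      length r
    ∎)
    where open ≡-Reasoning

  path-length : ∀ {l} → IsLambda G l →
                ∀ p → Linked (Adj G) p → Unique p → length p ≤ suc l
  path-length _                 []      _   _ = z≤n
  path-length {l} (_ , maximal) (x ∷ r) lnk u = s≤s (subst (_≤ l) (alternating-size x r)
    (maximal (odd-edges (x ∷ r)) (even-edges (x ∷ r)) (alternating-pair (x ∷ r) lnk u)))

  hamiltonian-λ : ∀ {l} → HasHamiltonianPath G → IsLambda G l → n G ≤ suc l
  hamiltonian-λ {l} (p , lnk , u , cover) isλ = begin
      n G       ≤⟨ covering⇒length≥ p cover ⟩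
      length p  ≤⟨ path-length isλ p lnk u ⟩
      suc l     ∎
    where open ≤-Reasoning

corollary4p4 : (G : Graph) → Connected G → HasHamiltonianPath G →
               (a b : ℕ) → IsMu G a → IsNu G b → a ≡ b
corollary4p4 G _ ham a b isμ isν with μ-half-λ G isμ
... | l , isλ , l≤2a = ≤-antisym (μ≤ν G isμ isν) (halve b a 2b≤2a+1)
  where
  open ≤-Reasoning
  2b≤2a+1 : b + b ≤ suc (a + a)
  2b≤2a+1 = begin
    b + b        ≤⟨ ν-bound G isν ⟩
    n G          ≤⟨ hamiltonian-λ G ham isλ ⟩
    suc l        ≤⟨ s≤s l≤2a ⟩
    suc (a + a)  ∎
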